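{- Let $a,b$ be coprime positive integers. Suppose a chip configuration $D\ge 0$ is $0$-stable and that, for some $s\in\{1,\dots,b\}$, the path $Q=\mathrm{lpath}(D)$ passes through the min-level point $v_s$ and the step of $Q$ ending at $v_s$ is an east step. Let $S$ be the set of the $s$ poorest vertices of $D$. Then $\beta_S$ is legal on $D$, and $Q_{v_s}=\mathrm{lpath}(\beta_S(D))$ (as labeled paths).
   Context: Write $[b]=\{1,\dots,b\}$. A chip configuration is $D:[b]\to\mathbb{Z}$; $D\ge0$ means all values nonnegative. For $S\subseteq[b]$ with $|S|=s$, $\phi_S$ subtracts $1+\lfloor (b-s)a/b\rfloor$ from $D(i)$ for $i\in S$ and adds $\lfloor sa/b\rfloor$ to $D(j)$ for $j\in[b]\setminus S$; $\beta_S=\phi_S^{ -1}$ adds $1+\lfloor (b-s)a/b\rfloor$ to $D(i)$ for $i\in S$ and subtracts $\lfloor sa/b\rfloor$ from $D(j)$ for $j\notin S$. For $D\ge 0$ a move is legal if its result is $\ge 0$. $D\ge 0$ is $0$-stable if no $\phi_{\{i\}}$ is legal on $D$. For $D\ge0$: $i$ is poorer than $j$ if $D(i)<D(j)$ or ($D(i)=D(j)$ and $i<j$); let $w_1,\dots,w_b$ be the vertices from poorest to richest, $x_t=D(w_t)$; the $s$ poorest vertices are $w_1,\dots,w_s$. $\mathrm{lpath}(D)$ is the lattice path from $(0,0)$ having, for each $t$, a north step from $(x_t,t-1)$ to $(x_t,t)$ labeled $w_t$, joined by east steps, ending with east steps to $(a,b)$ when $x_b\le a$. For a lattice point $v$ on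 a path $Q$ from $(0,0)$ to $(a,b)$, $Q_v$ is the path from the origin whose steps are those of $Q$ from $v$ to $(a,b)$ followed by those from $(0,0)$ to $v$, labels moving with north steps. The min-level points are $v_s=(\lfloor sa/b\rfloor,s)$ for $1\le s\le b-1$ and $v_b=(a-1,b)$. -}

module Defs where

open import Data.Nat as ℕ using (ℕ; zero; suc; _∸_; NonZero)
open import Data.Nat.DivMod using (_/_)
open import Data.Integer as ℤ using (ℤ; +_; ∣_∣)
open import Data.Fin as Fin using (Fin; toℕ)
open import Data.List using (List; []; _∷_; _++_; replicate; take; drop; length; allFin; foldr)
import Data.List.Membership.DecPropositional as DecMem
open import Data.Bool using (Bool; true; false; if_then_else_; _∨_; _∧_)
open import Data.Product using (_×_; _,_)
open import Relation.Nullary using (Dec; yes; no; ¬_)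
open import Relation.Nullary.Decidable using (⌊_⌋)
open import Relation.Binary.PropositionalEquality using (_≡_)

-- Chip configurations on the vertex set [b], vertex i ∈ [b] encoded as Fin b
-- (vertex i corresponds to toℕ i = i - 1, so the tie-break order is preserved).
Config : ℕ → Set
Config b = Fin b → ℤ

NonNeg : ∀ {b} → Config b → Set
NonNeg D = ∀ i → + 0 ℤ.≤ D i

module _ (a b : ℕ) .{{_ : NonZero b}} where

  open DecMem (Fin._≟_ {b}) using (_∈?_)

  -- φ_S for S given as a list of distinct vertices, s = |S|
  phi : List (Fin b) → Config b → Config b
  phi S D j with j ∈? S
  ... | yes _ = D j ℤ.- + (1 ℕ.+ ((b ∸ length S) ℕ.* a) / b)
  ... | no  _ = D j ℤ.+ + ((length S ℕ.* a) / b)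

  beta : List (Fin b) → Config b → Config b
  beta S D j with j ∈? S
  ... | yes _ = D j ℤ.+ + (1 ℕ.+ ((b ∸ length S) ℕ.* a) / b)
  ... | no  _ = D j ℤ.- + ((length S ℕ.* a) / b)

  Legal : (Config b → Config b) → Config b → Set
  Legal M D = NonNeg (M D)

  ZeroStable : Config b → Set
  ZeroStable D = NonNeg D × (∀ i → ¬ Legal (phi (i ∷ [])) D)

poorer : ∀ {b} → Config b → Fin b → Fin b → Bool
poorer D i j = ⌊ D i ℤ.<? D j ⌋ ∨ (⌊ D i ℤ.≟ D j ⌋ ∧ ⌊ toℕ i ℕ.<? toℕ j ⌋)

insertBy : ∀ {b} → Config b → Fin b → List (Fin b) → List (Fin b)
insertBy D x [] = x ∷ []
insertBy D x (y ∷ ys) = if poorer D x y then x ∷ y ∷ ys else y ∷ insertBy D x ys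

sortedVertices : ∀ {b} → Config b → List (Fin b)
sortedVertices {b} D = foldr (insertBy D) [] (allFin b)

poorest : ∀ {b} → ℕ → Config b → List (Fin b)
poorest s D = take s (sortedVertices D)

data Step (b : ℕ) : Set where
  E : Step b
  N : Fin b → Step b

Path : ℕ → Set
Path b = List (Step b)

endpoint : ∀ {b} → Path b → ℕ × ℕ
endpoint [] = 0 , 0
endpoint (E ∷ p) with endpoint p
... | x , y = suc x , y
endpoint (N _ ∷ p) with endpoint p
... | x , y = x , suc y

lpathFrom : ∀ {b} → ℕ → Config b → ℕ → List (Fin b) → Path b
lpathFrom a D prev [] = replicate (a ∸ prev) E
lpathFrom a D prev (w ∷ ws) =
  replicate (∣ D w ∣ ∸ prev) E ++ (N w ∷ lpathFrom a D ∣ D w ∣ ws)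

lpath : ∀ {b} → ℕ → Config b → Path b
lpath a D = lpathFrom a D 0 (sortedVertices D)

minLevel : (a b : ℕ) .{{_ : NonZero b}} → ℕ → ℕ × ℕ
minLevel a b s with s ℕ.<? b
... | yes _ = (s ℕ.* a) / b , s
... | no  _ = a ∸ 1 , b

-- Q_v where v is the lattice point reached after the first k steps of Q
rotate : ∀ {b} → ℕ → Path b → Path b
rotate k Q = drop k Q ++ take k Q

-- A 0-stable configuration has fewer than a chips on every vertex, so lpath D is the staircase from
-- column 0 to column a whose north steps sit at the sorted chip counts. Cutting it after a prefix that
-- ends at (c, s) separates the s poorest vertices, holding at most c chips, from the others, holding
-- at least c. For s < b coprimality gives ⌊sa/b⌋ + 1 + ⌊(b−s)a/b⌋ = a, so β_S raises the s poorest
-- by a − c and lowers the others by c. Each block keeps its internal order and every lowered vertex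
-- ends up strictly poorer than every raised one, so the new staircase is the old upper part shifted
-- left by c followed by the old lower part shifted right by a − c, which is the rotation Q_{v_s}.
module Submission where

open import Defs
open import Data.Nat using (ℕ; suc; _≤_; _<_; NonZero)
open import Data.Nat.Coprimality using (Coprime)
open import Data.List using (take; drop; head)
open import Data.Maybe using (just)
open import Data.Product using (_×_)
open import Relation.Binary.PropositionalEquality using (_≡_)

open import Data.Nat using (zero; z≤n; z<s; s<s; _+_; _*_; _∸_; _<?_; >-nonZero; >-nonZero⁻¹)
open import Data.Nat.Properties
open import Data.Nat.DivMod using (_/_; _%_; m≡m%n+[m/n]*n; m%n<n; m<n*o⇒m/o<n; 0/n≡0)
open import Data.Nat.Divisibility using (_∣_; m%n≡0⇒n∣m; ∣⇒≤)
import Data.Nat.Coprimality as Coprimality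
open import Data.Nat.Tactic.RingSolver using (solve-∀)
open import Data.Integer as ℤ using (ℤ; +_; ∣_∣; +≤+; +<+)
import Data.Integer.Properties as ℤ
open import Data.Fin as Fin using (Fin; toℕ)
open import Data.Fin.Properties using (toℕ-injective)
open import Data.Bool using (true; false; _∨_; _∧_)
open import Data.List using (List; []; _∷_; _++_; replicate; length; foldr; allFin)
open import Data.List.Properties using (++-assoc; ++-identityʳ; length-tabulate)
open import Data.List.Relation.Unary.Any using (here; there)
open import Data.List.Relation.Unary.All as All using (All; []; _∷_)
import Data.List.Relation.Unary.All.Properties as All
open import Data.List.Relation.Unary.AllPairs as AllPairs using (AllPairs; []; _∷_)
import Data.List.Relation.Unary.AllPairs.Properties as AllPairs
open import Data.List.Relation.Unary.Unique.Propositional using (Unique)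
open import Data.List.Relation.Unary.Unique.Propositional.Properties using (allFin⁺)
open import Data.List.Relation.Unary.Sorted.TotalOrder using (Sorted)
open import Data.List.Relation.Unary.Sorted.TotalOrder.Properties using (↗↭↗⇒≋; AllPairs⇒Sorted)
open import Data.List.Membership.Propositional using (_∈_; _∉_)
open import Data.List.Membership.Propositional.Properties using (∈-allFin; ∈-++⁻)
import Data.List.Membership.DecPropositional as DecMembership
open import Data.List.Relation.Binary.Permutation.Propositional
  using (_↭_; ↭-refl; ↭-prep; ↭-swap; ↭-trans; ↭-sym; ↭-reflexive; ↭⇒↭ₛ′)
open import Data.List.Relation.Binary.Permutation.Propositional.Properties
  using (All-resp-↭; ∈-resp-↭; ↭-length; ++-comm)
open import Data.List.Relation.Binary.Pointwise using (Pointwise-≡⇒≡)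
open import Data.Product using (_,_; proj₁; proj₂; map₂)
open import Data.Product.Relation.Binary.Lex.Strict using (×-Lex; ×-decidable; ×-isStrictTotalOrder)
open import Data.Sum using (inj₁; inj₂)
open import Data.Empty using (⊥-elim)
open import Function using (id; _∘_; _∘′_; _on_)
open import Function.Bundles using (_⇔_; mk⇔; Equivalence)
open import Level using (0ℓ)
open import Relation.Binary using (Rel; IsStrictTotalOrder; TotalOrder; Tri; tri<; tri≈; tri>)
import Relation.Binary.Properties.StrictTotalOrder as StrictTotalOrderProperties
open import Relation.Nullary using (¬_; Dec; yes; no; Reflects; ofʸ; ofⁿ; does; proof)
open import Relation.Nullary.Decidable using (isYes≗does)
open import Relation.Binary.PropositionalEquality
  using (_≢_; refl; sym; trans; cong; cong₂; subst; subst₂; isEquivalence; resp₂; module ≡-Reasoning)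

private variable
  b d p m e : ℕ
  g h : Fin b → ℕ
  w : Fin b
  ws us vs : List (Fin b)

floor-complement : ∀ {a b m n} .{{_ : NonZero b}} → ¬ b ∣ m → m + n ≡ a * b →
                   m / b + suc (n / b) ≡ a
floor-complement {a} {b} {m} {n} b∤m m+n≡ab = trans (+-suc (m / b) (n / b)) (≤-antisym q<a a≤1+q)
  where
  q r : ℕ
  q = m / b + n / b
  r = m % b + n % b
  division : r + q * b ≡ a * b
  division = begin
    r + q * b                                  ≡⟨ rearrange (m % b) (n % b) (m / b) (n / b) b ⟩
    (m % b + m / b * b) + (n % b + n / b * b)  ≡⟨ cong₂ _+_ (sym (m≡m%n+[m/n]*n m b)) (sym (m≡m%n+[m/n]*n n b)) ⟩
    m + n                                      ≡⟨ m+n≡ab ⟩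
    a * b                                      ∎
    where
    open ≡-Reasoning
    rearrange : ∀ x y u v w → x + y + (u + v) * w ≡ (x + u * w) + (y + v * w)
    rearrange = solve-∀
  -- r + q * b = a * b with 0 < r < 2 * b pins q down to a ∸ 1
  0<r : 0 < r
  0<r = ≤-trans (n≢0⇒n>0 (b∤m ∘′ m%n≡0⇒n∣m m b)) (m≤m+n (m % b) (n % b))
  q<a : q < a
  q<a = *-cancelʳ-< b q a (subst (q * b <_) division (m<n+m (q * b) 0<r))
  a≤1+q : a ≤ suc q
  a≤1+q = m<1+n⇒m≤n (*-cancelʳ-< b a (2 + q) (subst (_< b + (b + q * b)) division
            (subst (r + q * b <_) (+-assoc b b (q * b)) (+-monoˡ-< (q * b) (+-mono-< (m%n<n m b) (m%n<n n b))))))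

coprime⇒∤ : ∀ {a b s} → Coprime a b → 0 < s → s < b → ¬ b ∣ s * a
coprime⇒∤ {a} {b} {s} coprime 0<s s<b b∣sa = <⇒≱ s<b
  (∣⇒≤ {{>-nonZero 0<s}} (Coprimality.coprime-divisor (Coprimality.sym coprime) (subst (b ∣_) (*-comm s a) b∣sa)))

∸-telescope : p ≤ m → m ≤ e → (m ∸ p) + (e ∸ m) ≡ e ∸ p
∸-telescope {p} {m} {e} p≤m m≤e = trans (sym (+-∸-comm (e ∸ m) p≤m)) (cong (_∸ p) (m+[n∸m]≡n m≤e))

[m+o]∸[n+o]≡m∸n : ∀ m n o → (m + o) ∸ (n + o) ≡ m ∸ n
[m+o]∸[n+o]≡m∸n m n o = trans (cong₂ _∸_ (+-comm m o) (+-comm n o)) ([m+n]∸[m+o]≡n∸o o m n)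

+m-+n≡+[m∸n] : ∀ {m n} → n ≤ m → + m ℤ.- + n ≡ + (m ∸ n)
+m-+n≡+[m∸n] {m} {n} n≤m = trans (ℤ.m-n≡m⊖n m n) (ℤ.⊖-≥ n≤m)

replicate-+ : ∀ {A : Set} m n (x : A) → replicate (m + n) x ≡ replicate m x ++ replicate n x
replicate-+ zero    n x = refl
replicate-+ (suc m) n x = cong (x ∷_) (replicate-+ m n x)

take-length-++ : ∀ {A : Set} (xs : List A) {ys} → take (length xs) (xs ++ ys) ≡ xs
take-length-++ []       = refl
take-length-++ (x ∷ xs) = cong (x ∷_) (take-length-++ xs)

length-++-< : ∀ {A : Set} (xs : List A) {ys y} → y ∈ ys → length xs < length (xs ++ ys)
length-++-< []       (here _)  = z<s
length-++-< []       (there _) = z<s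
length-++-< (x ∷ xs) y∈ys      = s<s (length-++-< xs y∈ys)

AllPairs-++⁻ : ∀ {A : Set} {R : Rel A 0ℓ} {xs ys : List A} → AllPairs R (xs ++ ys) →
               AllPairs R xs × AllPairs R ys × All (λ x → All (R x) ys) xs
AllPairs-++⁻ {xs = []}     ys↗                  = [] , ys↗ , []
AllPairs-++⁻ {xs = x ∷ xs} (x≺xs++ys ∷ xs++ys↗) with AllPairs-++⁻ xs++ys↗
... | xs↗ , ys↗ , xs≺ys = All.++⁻ˡ xs x≺xs++ys ∷ xs↗ , ys↗ , All.++⁻ʳ xs x≺xs++ys ∷ xs≺ys

AllPairs-mapWith : ∀ {A : Set} {P : A → Set} {R S : Rel A 0ℓ} {xs} →
                   (∀ {x y} → P x → P y → R x y → S x y) → All P xs → AllPairs R xs → AllPairs S xs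
AllPairs-mapWith f []         []              = []
AllPairs-mapWith f (px ∷ pxs) (x≺xs ∷ sorted) =
  All.zipWith (λ (py , r) → f px py r) (pxs , x≺xs) ∷ AllPairs-mapWith f pxs sorted

-- Moves and min-level points

module _ (a b : ℕ) .{{_ : NonZero b}} where

  open DecMembership (Fin._≟_ {b}) using (_∈?_)

  phi-∈ : ∀ {S D j} → j ∈ S → phi a b S D j ≡ D j ℤ.- + (1 + (b ∸ length S) * a / b)
  phi-∈ {S} {j = j} j∈S with j ∈? S
  ... | yes _   = refl
  ... | no j∉S = ⊥-elim (j∉S j∈S)

  phi-∉ : ∀ {S D j} → j ∉ S → phi a b S D j ≡ D j ℤ.+ + (length S * a / b)
  phi-∉ {S} {j = j} j∉S with j ∈? S
  ... | yes j∈S = ⊥-elim (j∉S j∈S)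
  ... | no _    = refl

  beta-∈ : ∀ {S D j} → j ∈ S → beta a b S D j ≡ D j ℤ.+ + (1 + (b ∸ length S) * a / b)
  beta-∈ {S} {j = j} j∈S with j ∈? S
  ... | yes _   = refl
  ... | no j∉S = ⊥-elim (j∉S j∈S)

  beta-∉ : ∀ {S D j} → j ∉ S → beta a b S D j ≡ D j ℤ.- + (length S * a / b)
  beta-∉ {S} {j = j} j∉S with j ∈? S
  ... | yes j∈S = ⊥-elim (j∉S j∈S)
  ... | no _    = refl

  zeroStable⇒< : ∀ {D} → 0 < a → ZeroStable a b D → ∀ i → ∣ D i ∣ < a
  zeroStable⇒< {D} 0<a (D≥0 , unmovable) i with ∣ D i ∣ <? a
  ... | yes Di<a = Di<a
  ... | no  Di≮a = ⊥-elim (unmovable i legal)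
    where
    -- firing i alone costs it 1 + ⌊(b − 1)a/b⌋ ≤ a chips and only adds chips elsewhere
    fired≤a : 1 + (b ∸ 1) * a / b ≤ a
    fired≤a = m<n*o⇒m/o<n (subst ((b ∸ 1) * a <_) (*-comm b a)
                (*-monoˡ-< a {{>-nonZero 0<a}} (∸-monoʳ-< z<s (>-nonZero⁻¹ b))))
    legal : Legal a b (phi a b (i ∷ [])) D
    legal j = at (j Fin.≟ i)
      where
      at : Dec (j ≡ i) → + 0 ℤ.≤ phi a b (i ∷ []) D j
      at (yes refl) = subst (+ 0 ℤ.≤_) (sym (phi-∈ {S = i ∷ []} {D = D} (here refl)))
        (ℤ.i≤j⇒0≤j-i (subst (+ (1 + (b ∸ 1) * a / b) ℤ.≤_) (ℤ.0≤i⇒+∣i∣≡i (D≥0 i)) (+≤+ (≤-trans fired≤a (≮⇒≥ Di≮a)))))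
      at (no j≢i)   = subst (+ 0 ℤ.≤_) (sym (phi-∉ {S = i ∷ []} {D = D} λ { (here j≡i) → j≢i j≡i }))
        (ℤ.+-mono-≤ (D≥0 j) (+≤+ z≤n))

  minLevel-complement : ∀ {s} → 0 < a → Coprime a b → 0 < s → s ≤ b →
                        1 + (b ∸ s) * a / b ≡ a ∸ proj₁ (minLevel a b s)
  minLevel-complement {s} 0<a coprime 0<s s≤b with s <? b
  ... | yes s<b = begin
    1 + (b ∸ s) * a / b                            ≡⟨ sym (m+n∸m≡n (s * a / b) _) ⟩
    s * a / b + (1 + (b ∸ s) * a / b) ∸ s * a / b  ≡⟨ cong (_∸ (s * a / b)) (floor-complement (coprime⇒∤ coprime 0<s s<b) sum) ⟩
    a ∸ s * a / b                                  ∎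
    where
    open ≡-Reasoning
    sum : s * a + (b ∸ s) * a ≡ a * b
    sum = trans (sym (*-distribʳ-+ a s (b ∸ s))) (trans (cong (_* a) (m+[n∸m]≡n s≤b)) (*-comm b a))
  ... | no  s≮b = begin
    1 + (b ∸ s) * a / b   ≡⟨ cong (λ n → 1 + n * a / b) (trans (cong (b ∸_) (≤-antisym s≤b (≮⇒≥ s≮b))) (n∸n≡0 b)) ⟩
    1 + 0 / b             ≡⟨ cong suc (0/n≡0 b) ⟩
    1                     ≡⟨ sym (m∸[m∸n]≡n 0<a) ⟩
    a ∸ (a ∸ 1)           ∎
    where open ≡-Reasoning

  proj₁-minLevel : ∀ {s} → s < b → proj₁ (minLevel a b s) ≡ s * a / b
  proj₁-minLevel {s} s<b with s <? b
  ... | yes _   = refl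
  ... | no  s≮b = ⊥-elim (s≮b s<b)

  proj₂-minLevel : ∀ {s} → s ≤ b → proj₂ (minLevel a b s) ≡ s
  proj₂-minLevel {s} s≤b with s <? b
  ... | yes _   = refl
  ... | no  s≮b = ≤-antisym (≮⇒≥ s≮b) s≤b

module _ {a b : ℕ} .{{_ : NonZero b}} {S : List (Fin b)} {D : Config b} {s c : ℕ} {j : Fin b} where

  beta-raises : 0 < a → Coprime a b → length S ≡ s → 0 < s → s ≤ b → proj₁ (minLevel a b s) ≡ c →
                j ∈ S → beta a b S D j ≡ D j ℤ.+ + (a ∸ c)
  beta-raises 0<a coprime refl 0<s s≤b refl j∈S =
    trans (beta-∈ a b j∈S) (cong (λ n → D j ℤ.+ + n) (minLevel-complement a b 0<a coprime 0<s s≤b))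

  beta-lowers : length S ≡ s → length S < b → proj₁ (minLevel a b s) ≡ c →
                j ∉ S → beta a b S D j ≡ D j ℤ.- + c
  beta-lowers refl s<b refl j∉S =
    trans (beta-∉ a b j∉S) (cong (λ n → D j ℤ.- + n) (sym (proj₁-minLevel a b s<b)))

-- Staircase paths

staircase : (Fin b → ℕ) → ℕ → List (Fin b) → ℕ → Path b
staircase g p []       e = replicate (e ∸ p) E
staircase g p (w ∷ ws) e = replicate (g w ∸ p) E ++ N w ∷ staircase g (g w) ws e

chips : Config b → Fin b → ℕ
chips D i = ∣ D i ∣

lpath≡staircase : ∀ a (D : Config b) → lpath a D ≡ staircase (chips D) 0 (sortedVertices D) a
lpath≡staircase a D = go 0 (sortedVertices D)
  where
  go : ∀ p ws → lpathFrom a D p ws ≡ staircase (chips D) p ws a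
  go p []       = refl
  go p (w ∷ ws) = cong (λ path → replicate (chips D w ∸ p) E ++ N w ∷ path) (go (chips D w) ws)

data Ascending (g : Fin b → ℕ) : ℕ → List (Fin b) → ℕ → Set where
  []  : p ≤ e → Ascending g p [] e
  _∷_ : p ≤ g w → Ascending g (g w) ws e → Ascending g p (w ∷ ws) e

Ascending⇒≤ : Ascending g p ws e → p ≤ e
Ascending⇒≤ ([] p≤e)           = p≤e
Ascending⇒≤ (p≤gw ∷ ascending) = ≤-trans p≤gw (Ascending⇒≤ ascending)

Ascending⇒lowerBound : Ascending g p ws e → All (λ w → p ≤ g w) ws
Ascending⇒lowerBound ([] _)             = []
Ascending⇒lowerBound (p≤gw ∷ ascending) = p≤gw ∷ All.map (≤-trans p≤gw) (Ascending⇒lowerBound ascending)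

Ascending-weaken : m ≤ p → Ascending g p ws e → Ascending g m ws e
Ascending-weaken m≤p ([] p≤e)           = [] (≤-trans m≤p p≤e)
Ascending-weaken m≤p (p≤gw ∷ ascending) = ≤-trans m≤p p≤gw ∷ ascending

sorted⇒Ascending : AllPairs (λ v w → g v ≤ g w) ws → All (λ w → p ≤ g w) ws → All (λ w → g w ≤ e) ws →
                   p ≤ e → Ascending g p ws e
sorted⇒Ascending []              []         []             p≤e = [] p≤e
sorted⇒Ascending (w≤ws ∷ sorted) (p≤gw ∷ _) (gw≤e ∷ below) _   = p≤gw ∷ sorted⇒Ascending sorted w≤ws below gw≤e

Ascending-shift : All (λ w → g w ≡ h w + d) ws → Ascending h p ws e ⇔ Ascending g (p + d) ws (e + d)
Ascending-shift {g = g} {h = h} {d = d} shifted = mk⇔ (to shifted) (from shifted)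
  where
  to : ∀ {ws p e} → All (λ w → g w ≡ h w + d) ws → Ascending h p ws e → Ascending g (p + d) ws (e + d)
  to []                               ([] p≤e)           = [] (+-monoˡ-≤ d p≤e)
  to {w ∷ ws} {p} {e} (gw≡ ∷ shifted) (p≤hw ∷ ascending) =
    subst (p + d ≤_) (sym gw≡) (+-monoˡ-≤ d p≤hw) ∷ subst (λ q → Ascending g q ws (e + d)) (sym gw≡) (to shifted ascending)
  from : ∀ {ws p e} → All (λ w → g w ≡ h w + d) ws → Ascending g (p + d) ws (e + d) → Ascending h p ws e
  from []                               ([] p≤e)           = [] (+-cancelʳ-≤ d _ _ p≤e)
  from {w ∷ ws} {p} {e} (gw≡ ∷ shifted) (p≤gw ∷ ascending) =
    +-cancelʳ-≤ d p (h w) (subst (p + d ≤_) gw≡ p≤gw) ∷ from shifted (subst (λ q → Ascending g q ws (e + d)) gw≡ ascending)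

replicate-E-++ : p ≤ m → m ≤ e → (path : Path b) →
                 replicate (e ∸ p) E ++ path ≡ replicate (m ∸ p) E ++ replicate (e ∸ m) E ++ path
replicate-E-++ {p = p} {m = m} {e = e} p≤m m≤e path = begin
  replicate (e ∸ p) E ++ path                             ≡⟨ cong (λ k → replicate k E ++ path) (sym (∸-telescope p≤m m≤e)) ⟩
  replicate ((m ∸ p) + (e ∸ m)) E ++ path                 ≡⟨ cong (_++ path) (replicate-+ (m ∸ p) (e ∸ m) E) ⟩
  (replicate (m ∸ p) E ++ replicate (e ∸ m) E) ++ path    ≡⟨ ++-assoc (replicate (m ∸ p) E) _ path ⟩
  replicate (m ∸ p) E ++ replicate (e ∸ m) E ++ path      ∎
  where open ≡-Reasoning

staircase-from : p ≤ m → Ascending g m ws e → staircase g p ws e ≡ replicate (m ∸ p) E ++ staircase g m ws e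
staircase-from {p = p} {m = m} {ws = []} {e = e} p≤m ([] m≤e) =
  trans (sym (++-identityʳ _)) (trans (replicate-E-++ p≤m m≤e []) (cong (replicate (m ∸ p) E ++_) (++-identityʳ _)))
staircase-from p≤m (m≤gw ∷ _) = replicate-E-++ p≤m m≤gw _

staircase-east : Ascending g (suc p) ws e → staircase g p ws e ≡ E ∷ staircase g (suc p) ws e
staircase-east {g = g} {p = p} {ws = ws} {e = e} ascending =
  trans (staircase-from (n≤1+n p) ascending) (cong (λ k → replicate k E ++ staircase g (suc p) ws e) (m+n∸n≡m 1 p))

staircase-north : ∀ g w ws e → staircase {b} g (g w) (w ∷ ws) e ≡ N w ∷ staircase g (g w) ws e
staircase-north g w ws e = cong (λ k → replicate k E ++ N w ∷ staircase g (g w) ws e) (n∸n≡0 (g w))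

staircase-++ : Ascending g p us m → Ascending g m vs e →
               staircase g p (us ++ vs) e ≡ staircase g p us m ++ staircase g m vs e
staircase-++ {us = []} ([] p≤m) upper = staircase-from p≤m upper
staircase-++ {g = g} {p = p} {us = u ∷ us} (_ ∷ lower) upper =
  trans (cong (λ path → replicate (g u ∸ p) E ++ N u ∷ path) (staircase-++ lower upper))
        (sym (++-assoc (replicate (g u ∸ p) E) _ _))

staircase-shift : All (λ w → g w ≡ h w + d) ws → staircase g (p + d) ws (e + d) ≡ staircase h p ws e
staircase-shift {d = d} {p = p} {e = e} [] = cong (λ k → replicate k E) ([m+o]∸[n+o]≡m∸n e p d)
staircase-shift {h = h} {d = d} {ws = w ∷ ws} {p = p} (gw≡ ∷ shifted) rewrite gw≡ =
  cong₂ (λ k path → replicate k E ++ N w ∷ path) ([m+o]∸[n+o]≡m∸n (h w) p d) (staircase-shift shifted)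

staircase-rotate : ∀ {c t} {xs ys : List (Fin b)} → t + c ≡ e → Ascending g 0 xs c → Ascending g c ys e →
                   All (λ w → h w ≡ g w + t) xs → All (λ w → g w ≡ h w + c) ys →
                   staircase g c ys e ++ staircase g 0 xs c ≡ staircase h 0 (ys ++ xs) e
staircase-rotate {g = g} {h = h} {c = c} {t} {xs} {ys} refl lower upper raised lowered = begin
  staircase g c ys (t + c) ++ staircase g 0 xs c  ≡⟨ cong₂ _++_ (staircase-shift lowered) (sym (staircase-shift raised)) ⟩
  staircase h 0 ys t ++ staircase h t xs (c + t)  ≡⟨ cong (λ e → staircase h 0 ys t ++ staircase h t xs e) (+-comm c t) ⟩
  staircase h 0 ys t ++ staircase h t xs (t + c)  ≡⟨ sym (staircase-++ upper′ lower′) ⟩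
  staircase h 0 (ys ++ xs) (t + c)                ∎
  where
  open ≡-Reasoning
  upper′ : Ascending h 0 ys t
  upper′ = Equivalence.from (Ascending-shift lowered) upper
  lower′ : Ascending h t xs (t + c)
  lower′ = subst (Ascending h t xs) (+-comm c t) (Equivalence.to (Ascending-shift raised) lower)

endpoint-replicate-++ : ∀ k (path : Path b) →
                 endpoint (replicate k E ++ path) ≡ (k + proj₁ (endpoint path) , proj₂ (endpoint path))
endpoint-replicate-++ zero    path = refl
endpoint-replicate-++ (suc k) path rewrite endpoint-replicate-++ k path = refl

endpoint-staircase : Ascending g p ws e → endpoint (staircase g p ws e) ≡ (e ∸ p , length ws)
endpoint-staircase {p = p} {e = e} ([] p≤e) = begin
  endpoint (replicate (e ∸ p) E)        ≡⟨ cong endpoint (sym (++-identityʳ _)) ⟩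
  endpoint (replicate (e ∸ p) E ++ [])  ≡⟨ endpoint-replicate-++ (e ∸ p) [] ⟩
  (e ∸ p + 0 , 0)                       ≡⟨ cong (_, 0) (+-identityʳ (e ∸ p)) ⟩
  (e ∸ p , 0)                           ∎
  where open ≡-Reasoning
endpoint-staircase {g = g} {p = p} {ws = w ∷ ws} {e = e} (p≤gw ∷ ascending)
  rewrite endpoint-replicate-++ (g w ∸ p) (N w ∷ staircase g (g w) ws e) | endpoint-staircase ascending =
  cong (_, suc (length ws)) (∸-telescope p≤gw (Ascending⇒≤ ascending))

record Cut (g : Fin b → ℕ) (p : ℕ) (ws : List (Fin b)) (e n : ℕ) : Set where
  field
    lower upper     : List (Fin b)
    column          : ℕ
    split           : ws ≡ lower ++ upper
    lower-ascending : Ascending g p lower column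
    upper-ascending : Ascending g column upper e
    take-staircase  : take n (staircase g p ws e) ≡ staircase g p lower column
    drop-staircase  : drop n (staircase g p ws e) ≡ staircase g column upper e

cut-here : Ascending g p ws e → Cut g p ws e 0
cut-here {p = p} {ws = ws} ascending = record
  { lower = []; upper = ws; column = p; split = refl
  ; lower-ascending = [] ≤-refl; upper-ascending = ascending
  ; take-staircase = cong (λ k → replicate k E) (sym (n∸n≡0 p)); drop-staircase = refl
  }

cut-east : ∀ {n} → Ascending g (suc p) ws e → Cut g (suc p) ws e n → Cut g p ws e (suc n)
cut-east {g = g} {p = p} {ws = ws} {e = e} {n} ascending cut = record
  { lower = lower; upper = upper; column = column; split = split; upper-ascending = upper-ascending
  ; lower-ascending = Ascending-weaken (n≤1+n p) lower-ascending
  ; take-staircase  = begin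
      take (suc n) (staircase g p ws e)      ≡⟨ cong (take (suc n)) (staircase-east ascending) ⟩
      E ∷ take n (staircase g (suc p) ws e)  ≡⟨ cong (E ∷_) take-staircase ⟩
      E ∷ staircase g (suc p) lower column   ≡⟨ sym (staircase-east lower-ascending) ⟩
      staircase g p lower column             ∎
  ; drop-staircase  = trans (cong (drop (suc n)) (staircase-east ascending)) drop-staircase
  }
  where
  open Cut cut
  open ≡-Reasoning

cut-north : ∀ {n} → Cut g (g w) ws e n → Cut g (g w) (w ∷ ws) e (suc n)
cut-north {g = g} {w = w} {ws = ws} {e = e} {n = n} cut = record
  { lower = w ∷ lower; upper = upper; column = column; split = cong (w ∷_) split
  ; lower-ascending = ≤-refl ∷ lower-ascending; upper-ascending = upper-ascending
  ; take-staircase  = trans (cong (take (suc n)) (staircase-north g w ws e))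
                        (trans (cong (N w ∷_) take-staircase) (sym (staircase-north g w lower column)))
  ; drop-staircase  = trans (cong (drop (suc n)) (staircase-north g w ws e)) drop-staircase
  }
  where open Cut cut

cut-end : ∀ {n} → Cut g e [] e (suc n)
cut-end {g = g} {e = e} {n = n} = record
  { lower = []; upper = []; column = e; split = refl
  ; lower-ascending = [] ≤-refl; upper-ascending = [] ≤-refl
  ; take-staircase = trans (cong (take (suc n)) finished) (sym finished)
  ; drop-staircase = trans (cong (drop (suc n)) finished) (sym finished)
  }
  where
  finished : staircase g e [] e ≡ []
  finished = cong (λ k → replicate k E) (n∸n≡0 e)

staircase-cut : ∀ n → Ascending g p ws e → Cut g p ws e n
staircase-cut zero    ascending = cut-here ascending
staircase-cut (suc n) ([] p≤e) with m≤n⇒m<n∨m≡n p≤e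
... | inj₁ p<e  = cut-east ([] p<e) (staircase-cut n ([] p<e))
... | inj₂ refl = cut-end
staircase-cut (suc n) (p≤gw ∷ ascending) with m≤n⇒m<n∨m≡n p≤gw
... | inj₁ p<gw = cut-east (p<gw ∷ ascending) (staircase-cut n (p<gw ∷ ascending))
... | inj₂ refl = cut-north (staircase-cut n ascending)

module _ {n : ℕ} (cut : Cut g p ws e n) where

  open Cut cut

  cut-rotate : rotate n (staircase g p ws e) ≡ staircase g column upper e ++ staircase g p lower column
  cut-rotate = cong₂ _++_ drop-staircase take-staircase

  cut-endpoint : endpoint (take n (staircase g p ws e)) ≡ (column ∸ p , length lower)
  cut-endpoint = trans (cong endpoint take-staircase) (endpoint-staircase lower-ascending)

-- The poorer-than order

module Poorer {b : ℕ} (D : Config b) where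

  key : Fin b → ℤ × ℕ
  key i = D i , toℕ i

  infix 4 _≺_
  _≺_ : Rel (Fin b) 0ℓ
  _≺_ = ×-Lex _≡_ ℤ._<_ _<_ on key

  -- poorer is this lexicographic decision, written with ⌊_⌋ where the library uses does
  poorer-reflects : ∀ i j → Reflects (i ≺ j) (poorer D i j)
  poorer-reflects i j = subst (Reflects (i ≺ j)) (sym poorer≡does) (proof ≺?)
    where
    ≺? : Dec (i ≺ j)
    ≺? = ×-decidable ℤ._≟_ ℤ._<?_ _<?_ (key i) (key j)
    poorer≡does : poorer D i j ≡ does ≺?
    poorer≡does = cong₂ _∨_ (isYes≗does (D i ℤ.<? D j))
                    (cong₂ _∧_ (isYes≗does (D i ℤ.≟ D j)) (isYes≗does (toℕ i <? toℕ j)))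

  ≺-isStrictTotalOrder : IsStrictTotalOrder _≡_ _≺_
  ≺-isStrictTotalOrder = record
    { isStrictPartialOrder = record
      { isEquivalence = isEquivalence
      ; irrefl        = λ { refl → Lex.irrefl (refl , refl) }
      ; trans         = Lex.trans
      ; <-resp-≈      = resp₂ _≺_
      }
    ; compare = compare
    }
    where
    module Lex = IsStrictTotalOrder (×-isStrictTotalOrder ℤ.<-isStrictTotalOrder <-isStrictTotalOrder)
    compare : ∀ i j → Tri (i ≺ j) (i ≡ j) (j ≺ i)
    compare i j with Lex.compare (key i) (key j)
    ... | tri< i≺j i≉j j⊀i        = tri< i≺j (λ { refl → i≉j (refl , refl) }) j⊀i
    ... | tri≈ i⊀j (_ , same) j⊀i = tri≈ i⊀j (toℕ-injective same) j⊀i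
    ... | tri> i⊀j i≉j j≺i        = tri> i⊀j (λ { refl → i≉j (refl , refl) }) j≺i

  open IsStrictTotalOrder ≺-isStrictTotalOrder public
    using () renaming (irrefl to ≺-irrefl; trans to ≺-trans; compare to ≺-compare)

  totalOrder : TotalOrder 0ℓ 0ℓ 0ℓ
  totalOrder = StrictTotalOrderProperties.totalOrder (record { isStrictTotalOrder = ≺-isStrictTotalOrder })

  insertBy-↭ : ∀ x ys → insertBy D x ys ↭ x ∷ ys
  insertBy-↭ x []       = ↭-refl
  insertBy-↭ x (y ∷ ys) with poorer D x y
  ... | true  = ↭-refl
  ... | false = ↭-trans (↭-prep y (insertBy-↭ x ys)) (↭-swap y x ↭-refl)

  insertBy-sorted : ∀ {x ys} → All (x ≢_) ys → AllPairs _≺_ ys → AllPairs _≺_ (insertBy D x ys)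
  insertBy-sorted [] [] = [] ∷ []
  insertBy-sorted {x} {y ∷ ys} (x≢y ∷ x≢ys) (y≺ys ∷ sorted) with poorer D x y | poorer-reflects x y
  ... | true  | ofʸ x≺y = (x≺y ∷ All.map (≺-trans x≺y) y≺ys) ∷ y≺ys ∷ sorted
  ... | false | ofⁿ x⊀y = All-resp-↭ (↭-sym (insertBy-↭ x ys)) (y≺x ∷ y≺ys) ∷ insertBy-sorted x≢ys sorted
    where
    y≺x : y ≺ x
    y≺x with ≺-compare x y
    ... | tri< x≺y _ _ = ⊥-elim (x⊀y x≺y)
    ... | tri≈ _ x≡y _ = ⊥-elim (x≢y x≡y)
    ... | tri> _ _ y≺x = y≺x

  insertionSort-↭ : ∀ xs → foldr (insertBy D) [] xs ↭ xs
  insertionSort-↭ []       = ↭-refl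
  insertionSort-↭ (x ∷ xs) = ↭-trans (insertBy-↭ x _) (↭-prep x (insertionSort-↭ xs))

  insertionSort-sorted : ∀ {xs} → Unique xs → AllPairs _≺_ (foldr (insertBy D) [] xs)
  insertionSort-sorted []                       = []
  insertionSort-sorted {x ∷ xs} (x∉xs ∷ unique) =
    insertBy-sorted (All-resp-↭ (↭-sym (insertionSort-↭ xs)) x∉xs) (insertionSort-sorted unique)

  sortedVertices-↭ : sortedVertices D ↭ allFin b
  sortedVertices-↭ = insertionSort-↭ (allFin b)

  sortedVertices-sorted : AllPairs _≺_ (sortedVertices D)
  sortedVertices-sorted = insertionSort-sorted (allFin⁺ b)

  sorted-unique : ∀ {xs ys} → AllPairs _≺_ xs → AllPairs _≺_ ys → xs ↭ ys → xs ≡ ys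
  sorted-unique xs↗ ys↗ xs↭ys = Pointwise-≡⇒≡ (↗↭↗⇒≋ totalOrder (weaken xs↗) (weaken ys↗) (↭⇒↭ₛ′ isEquivalence xs↭ys))
    where
    weaken : ∀ {zs} → AllPairs _≺_ zs → Sorted totalOrder zs
    weaken = AllPairs⇒Sorted totalOrder ∘ AllPairs.map inj₁

open Poorer using (sortedVertices-sorted; sortedVertices-↭)

infix 4 _≺[_]_
_≺[_]_ : Fin b → Config b → Fin b → Set
i ≺[ D ] j = Poorer._≺_ D i j

module _ {D : Config b} where

  sortedVertices-disjoint : ∀ {xs ys j} → sortedVertices D ≡ xs ++ ys → j ∈ ys → j ∉ xs
  sortedVertices-disjoint split j∈ys j∈xs with AllPairs-++⁻ (subst (AllPairs (_≺[ D ]_)) split (sortedVertices-sorted D))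
  ... | _ , _ , xs≺ys = Poorer.≺-irrefl D refl (All.lookup (All.lookup xs≺ys j∈xs) j∈ys)

  sortedVertices-complete : ∀ j → j ∈ sortedVertices D
  sortedVertices-complete j = ∈-resp-↭ (↭-sym (sortedVertices-↭ D)) (∈-allFin j)

  sortedVertices-prefix< : ∀ {xs ys j} → sortedVertices D ≡ xs ++ ys → j ∈ ys → length xs < b
  sortedVertices-prefix< {xs} split j∈ys = subst (length xs <_)
    (trans (cong length (sym split)) (trans (↭-length (sortedVertices-↭ D)) (length-tabulate id)))
    (length-++-< xs j∈ys)

  sortedVertices-ascending : ∀ {a} → NonNeg D → (∀ i → chips D i < a) → Ascending (chips D) 0 (sortedVertices D) a
  sortedVertices-ascending D≥0 bounded = sorted⇒Ascending (AllPairs.map poorer⇒≤ (sortedVertices-sorted D))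
    (All.tabulate (λ _ → z≤n)) (All.tabulate (λ {i} _ → <⇒≤ (bounded i))) z≤n
    where
    +chips : ∀ i → + chips D i ≡ D i
    +chips i = ℤ.0≤i⇒+∣i∣≡i (D≥0 i)
    poorer⇒≤ : ∀ {i j} → i ≺[ D ] j → chips D i ≤ chips D j
    poorer⇒≤ {i} {j} (inj₁ Di<Dj)      = ℤ.drop‿+≤+ (subst₂ ℤ._≤_ (sym (+chips i)) (sym (+chips j)) (ℤ.<⇒≤ Di<Dj))
    poorer⇒≤         (inj₂ (Di≡Dj , _)) = ≤-reflexive (cong ∣_∣ Di≡Dj)

module _ {D D′ : Config b} where

  ≺-translate : ∀ {t x y} → D′ x ≡ D x ℤ.+ t → D′ y ≡ D y ℤ.+ t → x ≺[ D ] y → x ≺[ D′ ] y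
  ≺-translate {t} x≡ y≡ (inj₁ Dx<Dy)          = inj₁ (subst₂ ℤ._<_ (sym x≡) (sym y≡) (ℤ.+-monoˡ-< t Dx<Dy))
  ≺-translate {t} x≡ y≡ (inj₂ (Dx≡Dy , x<y)) = inj₂ (trans x≡ (trans (cong (ℤ._+ t) Dx≡Dy) (sym y≡)) , x<y)

  sortedVertices-rotate : ∀ {xs ys t u} → sortedVertices D ≡ xs ++ ys →
                          All (λ j → D′ j ≡ D j ℤ.+ t) xs → All (λ j → D′ j ≡ D j ℤ.+ u) ys →
                          All (λ y → All (λ x → D′ y ℤ.< D′ x) xs) ys → sortedVertices D′ ≡ ys ++ xs
  sortedVertices-rotate {xs} {ys} split xs≡ ys≡ ys<xs
    with AllPairs-++⁻ (subst (AllPairs (_≺[ D ]_)) split (sortedVertices-sorted D))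
  ... | xs↗ , ys↗ , _ = Poorer.sorted-unique D′ (sortedVertices-sorted D′) ys++xs↗ permutation
    where
    ys++xs↗ : AllPairs (_≺[ D′ ]_) (ys ++ xs)
    ys++xs↗ = AllPairs.++⁺ (AllPairs-mapWith ≺-translate ys≡ ys↗) (AllPairs-mapWith ≺-translate xs≡ xs↗)
                (All.map (All.map inj₁) ys<xs)
    permutation : sortedVertices D′ ↭ ys ++ xs
    permutation = ↭-trans (sortedVertices-↭ D′) (↭-trans (↭-sym (sortedVertices-↭ D))
                    (↭-trans (↭-reflexive split) (++-comm xs ys)))

module _ {a c : ℕ} {D D′ : Config b} {lower upper : List (Fin b)}
         (D≥0 : NonNeg D) (bounded : ∀ i → chips D i < a) (split : sortedVertices D ≡ lower ++ upper)
         (lower↗ : Ascending (chips D) 0 lower c) (upper↗ : Ascending (chips D) c upper a)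
         (raised : All (λ j → D′ j ≡ D j ℤ.+ + (a ∸ c)) lower)
         (lowered : All (λ j → D′ j ≡ D j ℤ.- + c) upper) where

  private
    c≤upper : ∀ {j} → j ∈ upper → c ≤ chips D j
    c≤upper = All.lookup (Ascending⇒lowerBound upper↗)

    raised⁺ : ∀ {j} → j ∈ lower → D′ j ≡ + (chips D j + (a ∸ c))
    raised⁺ {j} j∈ = trans (All.lookup raised j∈) (cong (ℤ._+ + (a ∸ c)) (sym (ℤ.0≤i⇒+∣i∣≡i (D≥0 j))))

    lowered⁺ : ∀ {j} → j ∈ upper → D′ j ≡ + (chips D j ∸ c)
    lowered⁺ {j} j∈ = trans (All.lookup lowered j∈)
                        (trans (cong (ℤ._- + c) (sym (ℤ.0≤i⇒+∣i∣≡i (D≥0 j)))) (+m-+n≡+[m∸n] (c≤upper j∈)))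

    nonNeg : NonNeg D′
    nonNeg j with ∈-++⁻ lower (subst (j ∈_) split (sortedVertices-complete j))
    ... | inj₁ j∈lower = subst (+ 0 ℤ.≤_) (sym (raised⁺ j∈lower)) (+≤+ z≤n)
    ... | inj₂ j∈upper = subst (+ 0 ℤ.≤_) (sym (lowered⁺ j∈upper)) (+≤+ z≤n)

    -- upper vertices drop below a ∸ c, lower vertices rise to at least a ∸ c
    sorted : sortedVertices D′ ≡ upper ++ lower
    sorted = sortedVertices-rotate split raised lowered
      (All.tabulate λ {y} y∈ → All.tabulate λ {x} x∈ → subst₂ ℤ._<_ (sym (lowered⁺ y∈)) (sym (raised⁺ x∈))
        (+<+ (<-≤-trans (∸-monoˡ-< (bounded y) (c≤upper y∈)) (m≤n+m (a ∸ c) (chips D x)))))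

  cut-shift : NonNeg D′ × staircase (chips D) c upper a ++ staircase (chips D) 0 lower c ≡ lpath a D′
  cut-shift = nonNeg , (begin
    staircase (chips D) c upper a ++ staircase (chips D) 0 lower c
      ≡⟨ staircase-rotate (m∸n+n≡m (Ascending⇒≤ upper↗)) lower↗ upper↗
           (All.tabulate (cong ∣_∣ ∘ raised⁺))
           (All.tabulate λ j∈ → sym (trans (cong ((_+ c) ∘ ∣_∣) (lowered⁺ j∈)) (m∸n+n≡m (c≤upper j∈)))) ⟩
    staircase (chips D′) 0 (upper ++ lower) a
      ≡⟨ cong (λ vs → staircase (chips D′) 0 vs a) (sym sorted) ⟩
    staircase (chips D′) 0 (sortedVertices D′) a
      ≡⟨ sym (lpath≡staircase a D′) ⟩
    lpath a D′ ∎)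
    where open ≡-Reasoning

lemma4p4 : (a b : ℕ) → .{{_ : NonZero b}} → 0 < a → Coprime a b →
    (D : Config b) → ZeroStable a b D →
    (s : ℕ) → 1 ≤ s → s ≤ b →
    (k : ℕ) → endpoint (take (suc k) (lpath a D)) ≡ minLevel a b s →
    head (drop k (lpath a D)) ≡ just E →
    Legal a b (beta a b (poorest s D)) D
    × rotate (suc k) (lpath a D) ≡ lpath a (beta a b (poorest s D) D)
lemma4p4 a b 0<a coprime D stable@(D≥0 , _) s 1≤s s≤b k reach _ =
  subst (λ S → Legal a b (beta a b S) D × rotate (suc k) (lpath a D) ≡ lpath a (beta a b S D))
        (sym poorest≡lower)
        (map₂ (trans rotated) (cut-shift D≥0 bounded split lower-ascending upper-ascending raised lowered))
  where
  bounded : ∀ i → chips D i < a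
  bounded = zeroStable⇒< a b 0<a stable
  cut : Cut (chips D) 0 (sortedVertices D) a (suc k)
  cut = staircase-cut (suc k) (sortedVertices-ascending D≥0 bounded)
  open Cut cut
  lpath≡ : lpath a D ≡ staircase (chips D) 0 (sortedVertices D) a
  lpath≡ = lpath≡staircase a D
  level : (column , length lower) ≡ minLevel a b s
  level = trans (sym (cut-endpoint cut)) (trans (cong (endpoint ∘ take (suc k)) (sym lpath≡)) reach)
  length≡s : length lower ≡ s
  length≡s = trans (cong proj₂ level) (proj₂-minLevel a b s≤b)
  poorest≡lower : poorest s D ≡ lower
  poorest≡lower = trans (cong₂ take (sym length≡s) split) (take-length-++ lower)
  rotated : rotate (suc k) (lpath a D) ≡ staircase (chips D) column upper a ++ staircase (chips D) 0 lower column
  rotated = trans (cong (rotate (suc k)) lpath≡) (cut-rotate cut)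
  raised : All (λ j → beta a b lower D j ≡ D j ℤ.+ + (a ∸ column)) lower
  raised = All.tabulate (beta-raises 0<a coprime length≡s 1≤s s≤b (cong proj₁ (sym level)))
  lowered : All (λ j → beta a b lower D j ≡ D j ℤ.- + column) upper
  lowered = All.tabulate λ j∈ →
    beta-lowers length≡s (sortedVertices-prefix< split j∈) (cong proj₁ (sym level)) (sortedVertices-disjoint split j∈)
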